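{- Let $G$ be a graph, $v$ a vertex of $G$, and $\varphi\in D(G)$ a deck transformation. Let $\gamma=\varphi([v])$. Then $\gamma\in\Pi_v^v(G)$ and $\varphi=\psi_\gamma$, i.e. $\varphi(\alpha)=\gamma*\alpha$ for every vertex $\alpha$ of $U_vG$.
   Context: All graphs are undirected, have no multiple edges, may have loops, are connected, and are not a single isolated vertex. A walk is a sequence $(v_0\cdots v_n)$ with $v_i\sim v_{i+1}$. A prune of a walk with $v_i=v_{i+2}$ replaces $v_iv_{i+1}v_i$ by $v_i$; a spider move on $(v_0\cdots v_n)$ replaces one $v_i$, $0<i<n$, by $v_i'$ with $v_{i-1}\sim v_i'\sim v_{i+1}$; walks are equivalent if connected by finitely many prunes, inverse prunes and spider moves. $\Pi(G)$ is the groupoid of vertices and equivalence classes of walks under concatenation ($\alpha*\beta$ = $\alpha$ then $\beta$); $\Pi_v(G)$ is the set of arrows with source $v$ and $\Pi_v^v(G)$ the group of arrows from $v$ to $v$. $U_vG$ is the graph whose vertices are the arrows of $\Pi_v(G)$, with $\alpha\sim\beta$ iff $\beta=\alpha*[(wx)]$ for an edge $w\sim x$ with $w$ the target of $\alpha$; $[v]$ is the class of the length-0 walk $(v)$; $\rho:U_vG\to G$ sends an arrow to its target. $D(G)$ is the group of graph automorphisms $\varphi$ of $U_vG$ with $\rho\circ\varphi=\rho$. For $\gamma\in\Pi_v^v(G)$, $\psi_\gamma(\alpha)=\gamma*\alpha$. -}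

module Defs where

open import Level using (0ℓ)
open import Data.Product using (Σ; ∃; ∃-syntax; _×_; _,_; proj₁; proj₂)
open import Relation.Binary.PropositionalEquality using (_≡_; refl)
open import Relation.Binary.Construct.Closure.Equivalence using (EqClosure)

-- A graph: vertex type, adjacency relation (symmetric, loops allowed).
-- "No multiple edges": adjacency is proof-irrelevant.
record Graph : Set₁ where
  field
    V      : Set
    _~_    : V → V → Set
    ~-sym  : ∀ {x y} → x ~ y → y ~ x
    ~-prop : ∀ {x y} (p q : x ~ y) → p ≡ q

module _ (G : Graph) where
  open Graph G

  data Walk : V → V → Set where
    nil  : ∀ v → Walk v v
    cons : ∀ {u x w} → u ~ x → Walk x w → Walk u w

  _++W_ : ∀ {u x w} → Walk u x → Walk x w → Walk u w
  nil _    ++W q = q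
  cons e p ++W q = cons e (p ++W q)

  -- Connected and not a single isolated vertex (given connectedness and
  -- non-emptiness, the latter means: some edge exists).
  record IsConnectedNontrivial : Set where
    field
      connected : ∀ x y → Walk x y
      hasEdge   : ∃[ x ] ∃[ y ] (x ~ y)

  data Step {u w : V} : Walk u w → Walk u w → Set where
    prune  : ∀ {a b} (p : Walk u a) (e : a ~ b) (e' : b ~ a) (q : Walk a w) →
             Step (p ++W cons e (cons e' q)) (p ++W q)
    spider : ∀ {a b b' c} (p : Walk u a) (e₁ : a ~ b) (e₂ : b ~ c)
             (e₁' : a ~ b') (e₂' : b' ~ c) (q : Walk c w) →
             Step (p ++W cons e₁ (cons e₂ q)) (p ++W cons e₁' (cons e₂' q))

  _≈W_ : ∀ {u w} → Walk u w → Walk u w → Set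
  _≈W_ {u} {w} = EqClosure (Step {u} {w})

  -- Arrows of Π_v(G): walks from v to some target, up to ≈W.
  Arrow : V → Set
  Arrow v = Σ V (Walk v)

  data _≋_ {v : V} : Arrow v → Arrow v → Set where
    same : ∀ {w} {p q : Walk v w} → p ≈W q → (w , p) ≋ (w , q)

  ρ : ∀ {v} → Arrow v → V
  ρ = proj₁

  [_] : ∀ v → Arrow v
  [ v ] = v , nil v

  extend : ∀ {v} (α : Arrow v) {x} → ρ α ~ x → Arrow v
  extend (w , p) {x} e = x , (p ++W cons e (nil x))

  _~U_ : ∀ {v} → Arrow v → Arrow v → Set
  α ~U β = Σ (ρ α ~ ρ β) (λ e → β ≋ extend α e)

  ψ : ∀ {v} → Walk v v → Arrow v → Arrow v
  ψ γ (w , p) = w , (γ ++W p)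

  record Deck (v : V) : Set where
    field
      φ       : Arrow v → Arrow v
      φ-cong  : ∀ {α β} → α ≋ β → φ α ≋ φ β
      φ⁻¹     : Arrow v → Arrow v
      φ⁻¹-cong : ∀ {α β} → α ≋ β → φ⁻¹ α ≋ φ⁻¹ β
      inv-l   : ∀ α → φ⁻¹ (φ α) ≋ α
      inv-r   : ∀ α → φ (φ⁻¹ α) ≋ α
      φ-adj   : ∀ {α β} → α ~U β → φ α ~U φ β
      φ-adj⁻  : ∀ {α β} → φ α ~U φ β → α ~U β
      φ-ρ     : ∀ α → ρ (φ α) ≡ ρ α

-- A deck transformation commutes with the extension of arrows by an edge: φ(α * e) is adjacent
-- to φ α in U_vG and lies over the same vertex as α * e, and since G has no multiple edges the
-- edge realising this adjacency is e itself, so φ(α * e) ≋ φ α * e. Writing φ [v] ≋ γ, the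
-- identity φ α ≋ γ * α therefore propagates from [v] along any walk representing α.
module Submission where

open import Defs
open import Data.Product using (Σ; _×_; _,_)
open import Relation.Binary.PropositionalEquality using (_≡_; refl; sym; cong)
open import Relation.Binary.Construct.Closure.Equivalence using (gmap)
open import Relation.Binary.Construct.Closure.ReflexiveTransitive using (ε; _◅◅_)

module DeckProperties (G : Graph) where
  open Graph G

  infixr 5 _++_
  _++_ : ∀ {u x w} → Walk G u x → Walk G x w → Walk G u w
  _++_ = _++W_ G

  infix 4 _≈_ _≃_
  _≈_ : ∀ {u w} → Walk G u w → Walk G u w → Set
  _≈_ = _≈W_ G

  _≃_ : ∀ {v} → Arrow G v → Arrow G v → Set
  _≃_ = _≋_ G

  ++-assoc : ∀ {a b c d} (p : Walk G a b) (q : Walk G b c) (r : Walk G c d) →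
    (p ++ q) ++ r ≡ p ++ (q ++ r)
  ++-assoc (nil _)    q r = refl
  ++-assoc (cons e p) q r = cong (cons e) (++-assoc p q r)

  ++-identityʳ : ∀ {a b} (p : Walk G a b) → p ++ nil b ≡ p
  ++-identityʳ (nil _)    = refl
  ++-identityʳ (cons e p) = cong (cons e) (++-identityʳ p)

  Step-++ʳ : ∀ {u w z} (r : Walk G w z) {s t : Walk G u w} →
    Step G s t → Step G (s ++ r) (t ++ r)
  Step-++ʳ r (prune p e e′ q)
    rewrite ++-assoc p (cons e (cons e′ q)) r | ++-assoc p q r =
      prune p e e′ (q ++ r)
  Step-++ʳ r (spider p e₁ e₂ e₁′ e₂′ q)
    rewrite ++-assoc p (cons e₁ (cons e₂ q)) r | ++-assoc p (cons e₁′ (cons e₂′ q)) r =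
      spider p e₁ e₂ e₁′ e₂′ (q ++ r)

  ≈-++ʳ : ∀ {u w z} (r : Walk G w z) {s t : Walk G u w} → s ≈ t → s ++ r ≈ t ++ r
  ≈-++ʳ r = gmap (_++ r) (Step-++ʳ r)

  ≃-refl : ∀ {v} {α : Arrow G v} → α ≃ α
  ≃-refl {α = _ , _} = same ε

  ≃-reflexive : ∀ {v} {α β : Arrow G v} → α ≡ β → α ≃ β
  ≃-reflexive refl = ≃-refl

  ≃-trans : ∀ {v} {α β γ : Arrow G v} → α ≃ β → β ≃ γ → α ≃ γ
  ≃-trans (same p) (same q) = same (p ◅◅ q)

  extend-cong : ∀ {v x y} {α β : Arrow G v} → α ≃ β →
    (e : ρ G α ~ x) (e′ : ρ G β ~ y) → x ≡ y → extend G α e ≃ extend G β e′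
  extend-cong {y = y} (same p≈q) e e′ refl with ~-prop e e′
  ... | refl = same (≈-++ʳ (cons e (nil y)) p≈q)

  extend-ψ : ∀ {v y} (γ : Walk G v v) (α : Arrow G v) (e : ρ G α ~ y) →
    extend G (ψ G γ α) e ≡ ψ G γ (extend G α e)
  extend-ψ {y = y} γ (_ , p) e = cong (y ,_) (++-assoc γ p (cons e (nil y)))

  arrow-loop : ∀ {v} (α : Arrow G v) → ρ G α ≡ v → Σ (Walk G v v) (λ γ → α ≃ (v , γ))
  arrow-loop (_ , p) refl = p , ≃-refl

  ψ-[] : ∀ {v} (γ : Walk G v v) → ψ G γ ([_] G v) ≡ (v , γ)
  ψ-[] {v} γ = cong (v ,_) (++-identityʳ γ)

  module _ {v} (D : Deck G v) (γ : Walk G v v) where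
    open Deck D

    φ≃ψ-extend : ∀ {y} {α : Arrow G v} → φ α ≃ ψ G γ α → (e : ρ G α ~ y) →
      φ (extend G α e) ≃ ψ G γ (extend G α e)
    φ≃ψ-extend {α = α} φα≃ e with φ-adj {α} {extend G α e} (e , ≃-refl)
    ... | e′ , φαe≃ =
      ≃-trans φαe≃
        (≃-trans (extend-cong φα≃ e′ e (φ-ρ (extend G α e)))
                 (≃-reflexive (extend-ψ γ α e)))

    φ≃ψ-++ : ∀ {x w} (q : Walk G v x) (r : Walk G x w) →
      φ (x , q) ≃ ψ G γ (x , q) → φ (w , q ++ r) ≃ ψ G γ (w , q ++ r)
    φ≃ψ-++ q (nil _) φq≃ rewrite ++-identityʳ q = φq≃
    φ≃ψ-++ q (cons {x = y} e r) φq≃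
      rewrite sym (++-assoc q (cons e (nil y)) r) =
        φ≃ψ-++ (q ++ cons e (nil y)) r (φ≃ψ-extend φq≃ e)

    φ≃ψ-from-[] : φ ([_] G v) ≃ ψ G γ ([_] G v) → ∀ α → φ α ≃ ψ G γ α
    φ≃ψ-from-[] φv≃ (w , p) = φ≃ψ-++ (nil v) p φv≃

open DeckProperties

lemma3p27 : (G : Graph) → IsConnectedNontrivial G → (v : Graph.V G) → (D : Deck G v) →
    Σ (Walk G v v) (λ γ →
    (_≋_ G (Deck.φ D ([_] G v)) (v , γ)) ×
    (∀ α → _≋_ G (Deck.φ D α) (ψ G γ α)))
lemma3p27 G _ v D with arrow-loop G (Deck.φ D ([_] G v)) (Deck.φ-ρ D ([_] G v))
... | γ , φv≃γ =
  γ , φv≃γ , φ≃ψ-from-[] G D γ (≃-trans G φv≃γ (≃-reflexive G (sym (ψ-[] G γ))))
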